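{- Let $X$ and $Y$ be directed graphs with $|V(X)|=|V(Y)|=n$. Then $\mathrm{ODP}(X,Y)=\mathrm{ODP}(Y,X)$.
   Context: For directed graphs $X,Y$ with the same number $n$ of vertices, $\mathrm{DFS}(X,Y)$ is the directed graph whose vertices are the bijections $\sigma:V(X)\to V(Y)$, with a directed edge from $\sigma$ to $\phi$ if and only if there exist distinct $a,b\in V(X)$ with $a\to b$ an edge of $X$, $\sigma(a)\to\sigma(b)$ an edge of $Y$, and $\phi=\sigma\circ(a\;b)$ (i.e. $\phi$ agrees with $\sigma$ except $\phi(a)=\sigma(b)$, $\phi(b)=\sigma(a)$). The outdegree polynomial is $\mathrm{ODP}(X,Y)=\sum_{v\in V(\mathrm{DFS}(X,Y))} x^{\mathrm{outdeg}(v)}$, where $\mathrm{outdeg}(v)$ is the outdegree of $v$ in $\mathrm{DFS}(X,Y)$. -}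

module Defs where

open import Data.Nat using (ℕ; zero; suc; _≡ᵇ_)
open import Data.Fin using (Fin; zero; suc; _<?_; _≟_)
open import Data.Bool using (Bool; true; false; _∧_; _∨_; not)
open import Data.List using (List; []; _∷_; [_]; map; concatMap; length; filterᵇ; cartesianProduct; allFin; foldr)
open import Data.Product using (_×_; _,_; proj₁; proj₂)
open import Relation.Nullary.Decidable using (⌊_⌋)

-- A directed graph on the vertex set Fin n, given by its (decidable) edge relation:
-- E a b ≡ true  iff  a → b is an edge.
Digraph : ℕ → Set
Digraph n = Fin n → Fin n → Bool

allFuns : (m n : ℕ) → List (Fin m → Fin n)
allFuns zero    n = [ (λ ()) ]
allFuns (suc m) n =
  concatMap (λ f → map (λ y → λ { zero → y ; (suc i) → f i }) (allFin n)) (allFuns m n)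

allᵇ : {A : Set} → (A → Bool) → List A → Bool
allᵇ p = foldr (λ x r → p x ∧ r) true

injectiveᵇ : {n : ℕ} → (Fin n → Fin n) → Bool
injectiveᵇ {n} f =
  allᵇ (λ i → allᵇ (λ j → ⌊ i ≟ j ⌋ ∨ not ⌊ f i ≟ f j ⌋) (allFin n)) (allFin n)

-- The vertices of DFS(X,Y): bijections Fin n → Fin n
-- (a map Fin n → Fin n is a bijection iff it is injective); each occurs exactly once.
bijections : (n : ℕ) → List (Fin n → Fin n)
bijections n = filterᵇ injectiveᵇ (allFuns n n)

-- The out-neighbours are σ ∘ (a b) for distinct a,b with
-- (a → b in X and σ a → σ b in Y); since (a b) = (b a) and distinct transpositions give
-- distinct φ, these are counted by unordered pairs {a,b} (a < b) such that
-- one of the two orientations qualifies.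
outdeg : {n : ℕ} → Digraph n → Digraph n → (Fin n → Fin n) → ℕ
outdeg {n} X Y σ = length (filterᵇ ok (cartesianProduct (allFin n) (allFin n)))
  where
  ok : Fin n × Fin n → Bool
  ok (a , b) = ⌊ a <? b ⌋ ∧ ((X a b ∧ Y (σ a) (σ b)) ∨ (X b a ∧ Y (σ b) (σ a)))

-- The outdegree polynomial ODP(X,Y) = Σ_σ x^{outdeg σ}, represented by its coefficient
-- function: ODP X Y k = coefficient of x^k = number of bijections σ with outdeg σ = k.
ODP : {n : ℕ} → Digraph n → Digraph n → ℕ → ℕ
ODP {n} X Y k = length (filterᵇ (λ σ → outdeg X Y σ ≡ᵇ k) (bijections n))

{-# OPTIONS --safe #-}
-- Inversion σ ↦ σ⁻¹ matches the vertices of DFS(X,Y) with those of DFS(Y,X) and preserves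
-- out-degrees: the transposition (a b) leads out of σ in DFS(X,Y) exactly when (σa σb) leads
-- out of σ⁻¹ in DFS(Y,X), because X a b ∧ Y (σ a) (σ b) is Y (σ a) (σ b) ∧ X (σ⁻¹ σ a) (σ⁻¹ σ b).
-- Both equalities of counts (out-edges of σ and σ⁻¹, bijections of out-degree k) come from
-- injections in both directions between duplicate-free enumerations.
module Submission where

open import Defs
open import Data.Bool using (Bool; true; false; _∧_; _∨_; not; T; T?; if_then_else_)
open import Data.Bool.Properties using (T-∧; ∨-comm; ∧-comm)
open import Data.Empty using (⊥-elim)
open import Data.Fin using (Fin; zero; suc; _<_; _<?_; _≟_; punchOut)
open import Data.Fin.Properties
  using (any?; injective⇒≤; punchOut-injective; <⇒≢; ≤∧≢⇒<; <-asym; <-cmp)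
open import Data.List
  using (List; []; _∷_; map; concatMap; length; lookup; filterᵇ; cartesianProduct; allFin)
open import Data.List.Properties using (filter-≐)
open import Data.List.Membership.Propositional using (_∈_)
open import Data.List.Membership.Propositional.Properties
  using (∈-allFin; ∈-cartesianProduct⁺; ∈-filter⁺; ∈-filter⁻)
  renaming (∈-lookup to ∈-lookup≡)
import Data.List.Membership.Setoid as SetoidMembership
import Data.List.Membership.Setoid.Properties as SetoidMembershipₚ
open import Data.List.Relation.Binary.Disjoint.Setoid using (Disjoint)
open import Data.List.Relation.Unary.All as All using (All; []; _∷_)
import Data.List.Relation.Unary.All.Properties as Allₚ
open import Data.List.Relation.Unary.AllPairs as AllPairs using ([]; _∷_)
import Data.List.Relation.Unary.AllPairs.Properties as AllPairsₚ
open import Data.List.Relation.Unary.Any as Any using (Any; here)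
import Data.List.Relation.Unary.Any.Properties as Anyₚ
open import Data.List.Relation.Unary.Unique.Setoid using (Unique)
import Data.List.Relation.Unary.Unique.Setoid.Properties as Uniqueₚ
open import Data.List.Relation.Unary.Unique.Propositional.Properties
  using (allFin⁺; cartesianProduct⁺)
open import Data.Nat using (ℕ; zero; suc; _≤_; _≡ᵇ_)
open import Data.Nat.Properties using (≤-antisym; 1+n≰n; ≮⇒≥; ≡ᵇ⇒≡; ≡⇒≡ᵇ)
open import Data.Product using (_×_; _,_; proj₁; proj₂; ∃; uncurry)
open import Data.Unit using (tt)
open import Function using (_∘_; const; _⇔_; mk⇔; Equivalence)
open import Function.Definitions using (Injective)
open import Level using (Level)
open import Relation.Binary.Bundles using (Setoid)
open import Relation.Binary.Definitions using (tri<; tri≈; tri>)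
open import Relation.Binary.PropositionalEquality
  using ( _≡_; _≢_; _≗_; refl; sym; trans; cong; cong₂; subst; setoid; _→-setoid_; ≢-sym
        ; module ≡-Reasoning)
open import Relation.Nullary using (Dec; yes; no; ¬_; contradiction)
open import Relation.Nullary.Decidable using (⌊_⌋; fromWitness; toWitness)

open Equivalence using (to; from)

private
  variable
    a b ℓ ℓ₁ ℓ₂ : Level
    A : Set a
    m n : ℕ

module _ (S : Setoid a ℓ) where
  open Setoid S using (_≈_) renaming (sym to ≈-sym)

  Unique⇒lookup-injective : ∀ {xs} → Unique S xs → ∀ {i j} → lookup xs i ≈ lookup xs j → i ≡ j
  Unique⇒lookup-injective {_ ∷ _} _         {zero}  {zero}  _  = refl
  Unique⇒lookup-injective {_ ∷ _} (x≉ ∷ _)  {zero}  {suc j} x≈ =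
    ⊥-elim (All.lookup x≉ (∈-lookup≡ j) x≈)
  Unique⇒lookup-injective {_ ∷ _} (x≉ ∷ _)  {suc i} {zero}  ≈x =
    ⊥-elim (All.lookup x≉ (∈-lookup≡ i) (≈-sym ≈x))
  Unique⇒lookup-injective {_ ∷ _} (_ ∷ xs!) {suc i} {suc j} eq =
    cong suc (Unique⇒lookup-injective xs! eq)

module _ (S : Setoid a ℓ₁) (R : Setoid b ℓ₂) where
  open Setoid S using () renaming (Carrier to C₁; _≈_ to _≈₁_)
  open Setoid R using () renaming (Carrier to C₂; _≈_ to _≈₂_)
  open SetoidMembership S using () renaming (_∈_ to _∈₁_)
  open SetoidMembership R using () renaming (_∈_ to _∈₂_)

  injectiveOn⇒length≤ : ∀ {xs ys} (f : C₁ → C₂) → Unique S xs →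
                        (∀ {x} → x ∈₁ xs → f x ∈₂ ys) →
                        (∀ {x y} → x ∈₁ xs → y ∈₁ xs → f x ≈₂ f y → x ≈₁ y) →
                        length xs ≤ length ys
  injectiveOn⇒length≤ {xs} f xs! f∈ f-inj = injective⇒≤ position-injective
    where
    x∈ : ∀ i → lookup xs i ∈₁ xs
    x∈ = SetoidMembershipₚ.∈-lookup S xs

    position : Fin (length xs) → Fin _
    position i = Any.index (f∈ (x∈ i))

    position-injective : Injective _≡_ _≡_ position
    position-injective {i} {j} eq = Unique⇒lookup-injective S xs! (f-inj (x∈ i) (x∈ j)
      (SetoidMembershipₚ.index-injective R (f∈ (x∈ i)) (f∈ (x∈ j)) eq))

module _ (extend : (Fin m → Fin n) → Fin n → Fin (suc m) → Fin n)
         (extend-zero : ∀ f y → extend f y zero ≡ y)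
         (extend-suc : ∀ f y i → extend f y (suc i) ≡ f i) where

  private
    S = Fin (suc m) →-setoid Fin n

    extensions : (Fin m → Fin n) → List (Fin (suc m) → Fin n)
    extensions f = map (extend f) (allFin n)

    ∈-extensions⁻ : ∀ {f g} → Any (g ≗_) (extensions f) → g ∘ suc ≗ f
    ∈-extensions⁻ g∈ i with y , _ , g≗ ← SetoidMembershipₚ.∈-map⁻ (setoid (Fin n)) S g∈ =
      trans (g≗ (suc i)) (extend-suc _ y i)

    extensions-unique : ∀ f → Unique S (extensions f)
    extensions-unique f = Uniqueₚ.map⁺ (setoid (Fin n)) S
      (λ e → trans (sym (extend-zero f _)) (trans (e zero) (extend-zero f _))) (allFin⁺ n)

  concatMap-extensions-unique : ∀ {fs} → Unique (Fin m →-setoid Fin n) fs →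
                                Unique S (concatMap extensions fs)
  concatMap-extensions-unique {fs} fs! = Uniqueₚ.concat⁺ S
    (Allₚ.map⁺ (All.universal extensions-unique fs))
    (AllPairsₚ.map⁺ (AllPairs.map disjoint fs!))
    where
    disjoint : ∀ {f f′} → ¬ (f ≗ f′) → Disjoint S (extensions f) (extensions f′)
    disjoint f≉f′ (g∈ , g∈′) =
      f≉f′ (λ i → trans (sym (∈-extensions⁻ g∈ i)) (∈-extensions⁻ g∈′ i))

  ∈-concatMap-extensions⁺ : ∀ {fs} g → Any (g ∘ suc ≗_) fs → Any (g ≗_) (concatMap extensions fs)
  ∈-concatMap-extensions⁺ g = SetoidMembershipₚ.∈-concat⁺ S ∘ Anyₚ.map⁺ ∘ Any.map g∈extensions
    where
    g∈extensions : ∀ {f} → g ∘ suc ≗ f → Any (g ≗_) (extensions f)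
    g∈extensions {f} g∘suc≗f =
      Anyₚ.map⁺ (Any.map (λ { refl → g≗extend }) (∈-allFin (g zero)))
      where
      g≗extend : g ≗ extend f (g zero)
      g≗extend zero    = sym (extend-zero f _)
      g≗extend (suc i) = trans (g∘suc≗f i) (sym (extend-suc f _ i))

-- The extension operation is the pattern lambda inside allFuns, found by unification.
allFuns-unique : ∀ m n → Unique (Fin m →-setoid Fin n) (allFuns m n)
allFuns-unique zero    n = [] ∷ []
allFuns-unique (suc m) n =
  concatMap-extensions-unique _ (λ _ _ → refl) (λ _ _ _ → refl) (allFuns-unique m n)

allFuns-complete : ∀ m n (g : Fin m → Fin n) → Any (g ≗_) (allFuns m n)
allFuns-complete zero    n g = here (λ ())
allFuns-complete (suc m) n g = ∈-concatMap-extensions⁺ _ (λ _ _ → refl) (λ _ _ _ → refl) g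
  (allFuns-complete m n (g ∘ suc))

T-allᵇ : {A : Set} (p : A → Bool) (xs : List A) → T (allᵇ p xs) ⇔ All (T ∘ p) xs
T-allᵇ p []       = mk⇔ (const []) (const tt)
T-allᵇ p (x ∷ xs) = mk⇔
  (λ t → let px , pxs = to T-∧ t in px ∷ to (T-allᵇ p xs) pxs)
  (λ { (px ∷ pxs) → from T-∧ (px , from (T-allᵇ p xs) pxs) })

T-allᵇ-allFin : (p : Fin n → Bool) → T (allᵇ p (allFin n)) ⇔ (∀ i → T (p i))
T-allᵇ-allFin p = mk⇔ (Allₚ.tabulate⁻ ∘ to (T-allᵇ p _)) (from (T-allᵇ p _) ∘ Allₚ.tabulate⁺)

T-⌊⌋∨not⌊⌋ : ∀ {p q} {P : Set p} {Q : Set q} (P? : Dec P) (Q? : Dec Q) →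
             T (⌊ P? ⌋ ∨ not ⌊ Q? ⌋) ⇔ (Q → P)
T-⌊⌋∨not⌊⌋ (yes p) _       = mk⇔ (λ _ _ → p) (const tt)
T-⌊⌋∨not⌊⌋ (no ¬p) (yes q) = mk⇔ (λ ()) (λ q⇒p → ¬p (q⇒p q))
T-⌊⌋∨not⌊⌋ (no ¬p) (no ¬q) = mk⇔ (λ _ q → contradiction q ¬q) (const tt)

T-injectiveᵇ : (σ : Fin n → Fin n) → T (injectiveᵇ σ) ⇔ Injective _≡_ _≡_ σ
T-injectiveᵇ σ = mk⇔
  (λ t {a} {b} → to (T-σa≡σb⇒a≡b a b) (to (T-allᵇ-allFin _) (to (T-allᵇ-allFin _) t a) b))
  (λ σ-inj → from (T-allᵇ-allFin _) λ a → from (T-allᵇ-allFin _) λ b →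
    from (T-σa≡σb⇒a≡b a b) σ-inj)
  where
  T-σa≡σb⇒a≡b : ∀ a b → T (⌊ a ≟ b ⌋ ∨ not ⌊ σ a ≟ σ b ⌋) ⇔ (σ a ≡ σ b → a ≡ b)
  T-σa≡σb⇒a≡b a b = T-⌊⌋∨not⌊⌋ (a ≟ b) (σ a ≟ σ b)

Injective-resp-≗ : ∀ {σ τ : Fin n → Fin n} → σ ≗ τ → Injective _≡_ _≡_ σ → Injective _≡_ _≡_ τ
Injective-resp-≗ σ≗τ σ-inj {a} {b} τa≡τb = σ-inj (trans (σ≗τ a) (trans τa≡τb (sym (σ≗τ b))))

module _ {n : ℕ} where
  private
    S = Fin n →-setoid Fin n

    injectiveᵇ-resp-≗ : ∀ {σ τ : Fin n → Fin n} → σ ≗ τ → T (injectiveᵇ σ) → T (injectiveᵇ τ)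
    injectiveᵇ-resp-≗ {σ} {τ} σ≗τ =
      from (T-injectiveᵇ τ) ∘ Injective-resp-≗ σ≗τ ∘ to (T-injectiveᵇ σ)

  bijections-unique : Unique S (bijections n)
  bijections-unique = Uniqueₚ.filter⁺ S (T? ∘ injectiveᵇ) {allFuns n n} (allFuns-unique n n)

  ∈-bijections⁺ : ∀ {σ} → Injective _≡_ _≡_ σ → Any (σ ≗_) (bijections n)
  ∈-bijections⁺ {σ} σ-inj = SetoidMembershipₚ.∈-filter⁺ S (T? ∘ injectiveᵇ) injectiveᵇ-resp-≗
    (allFuns-complete n n σ) (from (T-injectiveᵇ σ) σ-inj)

  ∈-bijections⁻ : ∀ {σ} → Any (σ ≗_) (bijections n) → Injective _≡_ _≡_ σ
  ∈-bijections⁻ {σ} σ∈ = to (T-injectiveᵇ σ) (proj₂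
    (SetoidMembershipₚ.∈-filter⁻ S (T? ∘ injectiveᵇ) injectiveᵇ-resp-≗ {xs = allFuns n n} σ∈))

injective⇒surjective : ∀ {σ : Fin n → Fin n} → Injective _≡_ _≡_ σ → ∀ c → ∃ λ a → σ a ≡ c
injective⇒surjective {suc n} {σ} σ-inj c with any? (λ a → σ a ≟ c)
... | yes hit  = hit
... | no  miss = contradiction (injective⇒≤ punched-injective) 1+n≰n
  where
  c≢σ : ∀ a → c ≢ σ a
  c≢σ a c≡σa = miss (a , sym c≡σa)

  punched-injective : Injective _≡_ _≡_ (λ a → punchOut (c≢σ a))
  punched-injective = σ-inj ∘ punchOut-injective (c≢σ _) (c≢σ _)

inverse : (Fin n → Fin n) → Fin n → Fin n
inverse σ c with any? (λ a → σ a ≟ c)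
... | yes (a , _) = a
... | no  _       = c

module _ {σ : Fin n → Fin n} (σ-inj : Injective _≡_ _≡_ σ) where

  inverseʳ : ∀ c → σ (inverse σ c) ≡ c
  inverseʳ c with any? (λ a → σ a ≟ c)
  ... | yes (_ , σa≡c) = σa≡c
  ... | no  miss       = contradiction (injective⇒surjective σ-inj c) miss

  inverseˡ : ∀ a → inverse σ (σ a) ≡ a
  inverseˡ a = σ-inj (inverseʳ (σ a))

  inverse-injective : Injective _≡_ _≡_ (inverse σ)
  inverse-injective {c} {d} eq = trans (sym (inverseʳ c)) (trans (cong σ eq) (inverseʳ d))

inverse-reflects-≗ : ∀ {σ τ : Fin n → Fin n} → Injective _≡_ _≡_ σ → Injective _≡_ _≡_ τ →
                     inverse σ ≗ inverse τ → σ ≗ τ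
inverse-reflects-≗ {σ = σ} {τ} σ-inj τ-inj eq a = begin
  σ a                 ≡⟨ cong σ (inverseˡ τ-inj a) ⟨
  σ (inverse τ (τ a)) ≡⟨ cong σ (eq (τ a)) ⟨
  σ (inverse σ (τ a)) ≡⟨ inverseʳ σ-inj (τ a) ⟩
  τ a                 ∎
  where open ≡-Reasoning

ordered : Fin n → Fin n → Fin n × Fin n
ordered c d = if ⌊ c <? d ⌋ then (c , d) else (d , c)

ordered-< : ∀ {c d : Fin n} → c < d → ordered c d ≡ (c , d)
ordered-< {c = c} {d} c<d with c <? d
... | yes _   = refl
... | no  c≮d = contradiction c<d c≮d

ordered-> : ∀ {c d : Fin n} → d < c → ordered c d ≡ (d , c)
ordered-> {c = c} {d} d<c with c <? d
... | yes c<d = contradiction d<c (<-asym c<d)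
... | no  _   = refl

ordered-comm : ∀ (c d : Fin n) → ordered c d ≡ ordered d c
ordered-comm c d with <-cmp c d
... | tri< c<d _ _  = trans (ordered-< c<d) (sym (ordered-> c<d))
... | tri≈ _ refl _ = refl
... | tri> _ _ d<c  = trans (ordered-> d<c) (sym (ordered-< d<c))

ordered-increasing : ∀ {c d : Fin n} → c ≢ d → uncurry _<_ (ordered c d)
ordered-increasing {c = c} {d} c≢d with c <? d
... | yes c<d = c<d
... | no  c≮d = ≤∧≢⇒< (≮⇒≥ c≮d) (≢-sym c≢d)

uncurry-ordered : (h : Fin n → Fin n → A) → (∀ c d → h c d ≡ h d c) →
                  ∀ c d → uncurry h (ordered c d) ≡ h c d
uncurry-ordered h h-sym c d with ⌊ c <? d ⌋
... | true  = refl
... | false = h-sym d c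

orderedImage : (Fin n → Fin n) → Fin n × Fin n → Fin n × Fin n
orderedImage σ (a , b) = ordered (σ a) (σ b)

swappable : Digraph n → Digraph n → (Fin n → Fin n) → Fin n → Fin n → Bool
swappable X Y σ a b = (X a b ∧ Y (σ a) (σ b)) ∨ (X b a ∧ Y (σ b) (σ a))

-- The predicate `ok` of outdeg, so that outdeg X Y σ is length (arcs X Y σ) by definition.
arc : Digraph n → Digraph n → (Fin n → Fin n) → Fin n × Fin n → Bool
arc X Y σ (a , b) = ⌊ a <? b ⌋ ∧ swappable X Y σ a b

pairs : (n : ℕ) → List (Fin n × Fin n)
pairs n = cartesianProduct (allFin n) (allFin n)

arcs : Digraph n → Digraph n → (Fin n → Fin n) → List (Fin n × Fin n)
arcs {n} X Y σ = filterᵇ (arc X Y σ) (pairs n)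

module _ (X Y : Digraph n) (σ : Fin n → Fin n) where

  arc⁺ : ∀ {a b} → a < b → T (swappable X Y σ a b) → T (arc X Y σ (a , b))
  arc⁺ a<b ab-swappable = from T-∧ (fromWitness a<b , ab-swappable)

  arc⁻ : ∀ {a b} → T (arc X Y σ (a , b)) → a < b × T (swappable X Y σ a b)
  arc⁻ {a} t with a<b , ab-swappable ← to (T-∧ {⌊ a <? _ ⌋}) t = toWitness a<b , ab-swappable

  swappable-sym : ∀ a b → swappable X Y σ a b ≡ swappable X Y σ b a
  swappable-sym a b = ∨-comm (X a b ∧ Y (σ a) (σ b)) (X b a ∧ Y (σ b) (σ a))

  outdeg-cong : ∀ {τ} → σ ≗ τ → outdeg X Y σ ≡ outdeg X Y τ
  outdeg-cong {τ} σ≗τ = cong length (filter-≐ (T? ∘ arc X Y σ) (T? ∘ arc X Y τ)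
    ((λ {p} → subst T (arc-cong p)) , (λ {p} → subst T (sym (arc-cong p)))) (pairs n))
    where
    arc-cong : ∀ p → arc X Y σ p ≡ arc X Y τ p
    arc-cong (a , b) =
      cong₂ (λ c d → ⌊ a <? b ⌋ ∧ ((X a b ∧ Y c d) ∨ (X b a ∧ Y d c))) (σ≗τ a) (σ≗τ b)

swappable-inverse : (X Y : Digraph n) {σ ρ : Fin n → Fin n} → (∀ a → ρ (σ a) ≡ a) →
                    ∀ a b → swappable Y X ρ (σ a) (σ b) ≡ swappable X Y σ a b
swappable-inverse X Y {σ} {ρ} ρσ≗id a b = begin
  (Y (σ a) (σ b) ∧ X (ρ (σ a)) (ρ (σ b))) ∨ (Y (σ b) (σ a) ∧ X (ρ (σ b)) (ρ (σ a)))
    ≡⟨ cong₂ (λ c d → (Y (σ a) (σ b) ∧ X c d) ∨ (Y (σ b) (σ a) ∧ X d c)) (ρσ≗id a) (ρσ≗id b) ⟩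
  (Y (σ a) (σ b) ∧ X a b) ∨ (Y (σ b) (σ a) ∧ X b a)
    ≡⟨ cong₂ _∨_ (∧-comm (Y (σ a) (σ b)) (X a b)) (∧-comm (Y (σ b) (σ a)) (X b a)) ⟩
  swappable X Y σ a b ∎
  where open ≡-Reasoning

module _ (X Y : Digraph n) {σ ρ : Fin n → Fin n} (ρσ≗id : ∀ a → ρ (σ a) ≡ a) where

  private
    σ-injective : Injective _≡_ _≡_ σ
    σ-injective {a} {b} σa≡σb = trans (sym (ρσ≗id a)) (trans (cong ρ σa≡σb) (ρσ≗id b))

  arc-orderedImage : ∀ p → T (arc X Y σ p) → T (arc Y X ρ (orderedImage σ p))
  arc-orderedImage (a , b) t with a<b , ab-swappable ← arc⁻ X Y σ t =
    arc⁺ Y X ρ (ordered-increasing (<⇒≢ a<b ∘ σ-injective))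
               (subst T (sym image-swappable) ab-swappable)
    where
    image-swappable : uncurry (swappable Y X ρ) (ordered (σ a) (σ b)) ≡ swappable X Y σ a b
    image-swappable = trans (uncurry-ordered _ (swappable-sym Y X ρ) (σ a) (σ b))
                            (swappable-inverse X Y {σ} {ρ} ρσ≗id a b)

  orderedImage-cancel : ∀ p → T (arc X Y σ p) → orderedImage ρ (orderedImage σ p) ≡ p
  orderedImage-cancel (a , b) t = begin
    orderedImage ρ (ordered (σ a) (σ b)) ≡⟨ uncurry-ordered ordered-ρ ordered-ρ-comm (σ a) (σ b) ⟩
    ordered (ρ (σ a)) (ρ (σ b))          ≡⟨ cong₂ ordered (ρσ≗id a) (ρσ≗id b) ⟩
    ordered a b                          ≡⟨ ordered-< (proj₁ (arc⁻ X Y σ t)) ⟩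
    (a , b)                              ∎
    where
    open ≡-Reasoning
    ordered-ρ : Fin n → Fin n → Fin n × Fin n
    ordered-ρ c d = ordered (ρ c) (ρ d)
    ordered-ρ-comm : ∀ c d → ordered-ρ c d ≡ ordered-ρ d c
    ordered-ρ-comm c d = ordered-comm (ρ c) (ρ d)

  outdeg-≤ : outdeg X Y σ ≤ outdeg Y X ρ
  outdeg-≤ = injectiveOn⇒length≤ (setoid _) (setoid _) {arcs X Y σ} {arcs Y X ρ} (orderedImage σ)
    (Uniqueₚ.filter⁺ (setoid _) (T? ∘ arc X Y σ) {pairs n}
      (cartesianProduct⁺ (allFin⁺ n) (allFin⁺ n)))
    image∈
    (λ p∈ q∈ eq → trans (sym (cancel p∈)) (trans (cong (orderedImage ρ) eq) (cancel q∈)))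
    where
    arc-of-member : ∀ {p} → p ∈ arcs X Y σ → T (arc X Y σ p)
    arc-of-member p∈ = proj₂ (∈-filter⁻ (T? ∘ arc X Y σ) {xs = pairs n} p∈)

    image∈ : ∀ {p} → p ∈ arcs X Y σ → orderedImage σ p ∈ arcs Y X ρ
    image∈ {p} p∈ = ∈-filter⁺ (T? ∘ arc Y X ρ) (∈-cartesianProduct⁺ (∈-allFin _) (∈-allFin _))
      (arc-orderedImage p (arc-of-member p∈))

    cancel : ∀ {p} → p ∈ arcs X Y σ → orderedImage ρ (orderedImage σ p) ≡ p
    cancel {p} p∈ = orderedImage-cancel p (arc-of-member p∈)

outdeg-inverse : (X Y : Digraph n) {σ : Fin n → Fin n} → Injective _≡_ _≡_ σ →
                 outdeg X Y σ ≡ outdeg Y X (inverse σ)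
outdeg-inverse X Y σ-inj =
  ≤-antisym (outdeg-≤ X Y (inverseˡ σ-inj)) (outdeg-≤ Y X (inverseʳ σ-inj))

outdegClass : Digraph n → Digraph n → ℕ → List (Fin n → Fin n)
outdegClass {n} X Y k = filterᵇ (λ σ → outdeg X Y σ ≡ᵇ k) (bijections n)

module _ (X Y : Digraph n) (k : ℕ) where
  private
    S = Fin n →-setoid Fin n

    has-outdeg : (Fin n → Fin n) → Bool
    has-outdeg σ = outdeg X Y σ ≡ᵇ k

    has-outdeg-resp-≗ : ∀ {σ τ} → σ ≗ τ → T (has-outdeg σ) → T (has-outdeg τ)
    has-outdeg-resp-≗ {σ} σ≗τ = subst (λ d → T (d ≡ᵇ k)) (outdeg-cong X Y σ σ≗τ)

  outdegClass-unique : Unique S (outdegClass X Y k)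
  outdegClass-unique = Uniqueₚ.filter⁺ S (T? ∘ has-outdeg) {bijections n} bijections-unique

  ∈-outdegClass⁺ : ∀ {σ} → Injective _≡_ _≡_ σ → outdeg X Y σ ≡ k →
                   Any (σ ≗_) (outdegClass X Y k)
  ∈-outdegClass⁺ σ-inj deg = SetoidMembershipₚ.∈-filter⁺ S (T? ∘ has-outdeg) has-outdeg-resp-≗
    (∈-bijections⁺ σ-inj) (≡⇒≡ᵇ _ _ deg)

  ∈-outdegClass⁻ : ∀ {σ} → Any (σ ≗_) (outdegClass X Y k) →
                   Injective _≡_ _≡_ σ × outdeg X Y σ ≡ k
  ∈-outdegClass⁻ σ∈
    with σ∈bijections , deg ← SetoidMembershipₚ.∈-filter⁻ S (T? ∘ has-outdeg) has-outdeg-resp-≗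
                                {xs = bijections n} σ∈
    = ∈-bijections⁻ σ∈bijections , ≡ᵇ⇒≡ _ _ deg

ODP-≤ : (X Y : Digraph n) (k : ℕ) → ODP X Y k ≤ ODP Y X k
ODP-≤ {n} X Y k = injectiveOn⇒length≤ S S {outdegClass X Y k} {outdegClass Y X k} inverse
  (outdegClass-unique X Y k) inverse∈ inverse-injectiveOn
  where
  S = Fin n →-setoid Fin n

  inverse∈ : ∀ {σ} → Any (σ ≗_) (outdegClass X Y k) → Any (inverse σ ≗_) (outdegClass Y X k)
  inverse∈ σ∈ with σ-inj , deg ← ∈-outdegClass⁻ X Y k σ∈ =
    ∈-outdegClass⁺ Y X k (inverse-injective σ-inj) (trans (sym (outdeg-inverse X Y σ-inj)) deg)

  inverse-injectiveOn : ∀ {σ τ} → Any (σ ≗_) (outdegClass X Y k) →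
                        Any (τ ≗_) (outdegClass X Y k) → inverse σ ≗ inverse τ → σ ≗ τ
  inverse-injectiveOn σ∈ τ∈ =
    inverse-reflects-≗ (proj₁ (∈-outdegClass⁻ X Y k σ∈)) (proj₁ (∈-outdegClass⁻ X Y k τ∈))

corollary3p2 : (n : ℕ) (X Y : Digraph n) → (k : ℕ) → ODP X Y k ≡ ODP Y X k
corollary3p2 n X Y k = ≤-antisym (ODP-≤ X Y k) (ODP-≤ Y X k)
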